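{- Let $\mathcal{BIP}$ be the class of bipartite graphs. For all integers $k\geq 2$ and $i\geq 2k+3$, and all integers $j\ge k+2$, $$R_{k}^{\mathcal{BIP}}(i,j)=\begin{cases}2j-1-k, & \text{if } k+2\leq j\leq 2k,\\ 2j-1, & \text{if } j\geq 2k+1.\end{cases}$$
   Context: All graphs are finite and simple. For a graph $G$ and an integer $k\ge 0$, a $k$-sparse $j$-set is a set of exactly $j$ vertices of $G$ inducing a subgraph of maximum degree at most $k$; a $k$-dense $i$-set is a set of exactly $i$ vertices that is $k$-sparse in the complement of $G$. For a graph class $\mathcal{G}$, $R_k^{\mathcal{G}}(i,j)$ is the smallest natural number $n$ such that every graph on $n$ vertices in $\mathcal{G}$ has a $k$-dense $i$-set or a $k$-sparse $j$-set. -}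

module Defs where

open import Data.Nat using (ℕ; _≤_; _<_)
open import Data.Bool using (Bool; true; false; not; _∧_)
open import Data.Fin using (Fin; _≟_)
open import Data.Fin.Subset using (Subset; _∈_; _∩_; ∣_∣)
open import Data.Vec using (tabulate)
open import Data.Product using (Σ; _×_)
open import Data.Sum using (_⊎_)
open import Relation.Nullary using (¬_)
open import Relation.Nullary.Decidable using (⌊_⌋)
open import Relation.Binary.PropositionalEquality using (_≡_; _≢_)

record Graph (n : ℕ) : Set where
  field
    adj   : Fin n → Fin n → Bool
    sym   : ∀ u v → adj u v ≡ adj v u
    irrefl : ∀ v → adj v v ≡ false
open Graph public

complement : ∀ {n} → Graph n → Graph n
complement {n} G = record
  { adj = λ u v → not (adj G u v) ∧ not ⌊ u ≟ v ⌋
  ; sym = λ u v → symProof u v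
  ; irrefl = λ v → irr v
  }
  where
  open import Relation.Binary.PropositionalEquality using (refl; cong₂; cong)
  open import Relation.Nullary using (yes; no)
  symProof : ∀ u v → (not (adj G u v) ∧ not ⌊ u ≟ v ⌋) ≡ (not (adj G v u) ∧ not ⌊ v ≟ u ⌋)
  symProof u v with u ≟ v | v ≟ u
  ... | yes _ | yes _ = cong₂ _∧_ (cong not (Graph.sym G u v)) refl
  ... | no _  | no _  = cong₂ _∧_ (cong not (Graph.sym G u v)) refl
  ... | yes p | no q  = ⊥-elim (q (Eq.sym p))
    where open import Data.Empty using (⊥-elim)
          import Relation.Binary.PropositionalEquality as Eq
  ... | no p  | yes q = ⊥-elim (p (Eq.sym q))
    where open import Data.Empty using (⊥-elim)
          import Relation.Binary.PropositionalEquality as Eq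
  irr : ∀ v → (not (adj G v v) ∧ not ⌊ v ≟ v ⌋) ≡ false
  irr v with v ≟ v
  ... | yes _ = Data.Bool.Properties.∧-zeroʳ (not (adj G v v))
    where import Data.Bool.Properties
  ... | no ¬p = ⊥-elim (¬p refl)
    where open import Data.Empty using (⊥-elim)

nbhd : ∀ {n} → Graph n → Fin n → Subset n
nbhd G v = tabulate (adj G v)

inducedDegree : ∀ {n} → Graph n → Subset n → Fin n → ℕ
inducedDegree G S v = ∣ nbhd G v ∩ S ∣

MaxDegAtMost : ∀ {n} → ℕ → Graph n → Subset n → Set
MaxDegAtMost k G S = ∀ v → v ∈ S → inducedDegree G S v ≤ k

HasSparseSet : ∀ {n} → ℕ → ℕ → Graph n → Set
HasSparseSet {n} k j G = Σ (Subset n) λ S → (∣ S ∣ ≡ j) × MaxDegAtMost k G S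

HasDenseSet : ∀ {n} → ℕ → ℕ → Graph n → Set
HasDenseSet k i G = HasSparseSet k i (complement G)

Bipartite : ∀ {n} → Graph n → Set
Bipartite {n} G = Σ (Fin n → Bool) λ c → ∀ u v → adj G u v ≡ true → c u ≢ c v

RamseyPropBIP : ℕ → ℕ → ℕ → ℕ → Set
RamseyPropBIP k i j n = (G : Graph n) → Bipartite G → HasDenseSet k i G ⊎ HasSparseSet k j G

RBIP≡ : ℕ → ℕ → ℕ → ℕ → Set
RBIP≡ k i j m = RamseyPropBIP k i j m × (∀ n → n < m → ¬ RamseyPropBIP k i j n)

-- In a bipartite graph both colour classes are cliques of the complement, so a k-dense set has at most
-- k + 1 vertices in each class, i.e. at most 2k + 2 < i vertices; only sparse j-sets matter. The degree
-- of a vertex inside S is at most the number of vertices of S in the other class, so S is k-sparse if it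
-- lies in one class or has at most k vertices in each. Hence 2j - 1 vertices force j of them into one
-- class, and for j ≤ 2k already 2j - 1 - k vertices leave room for a mixed choice. Conversely, in the
-- complete bipartite graph with a class of j - 1 vertices a mixed k-sparse set has at most k vertices on
-- each side, which shows that no fewer vertices suffice.
module Submission where

open import Defs
open import Data.Nat using (ℕ; zero; suc; _≤_; _<_; _+_; _*_; _∸_; z≤n; s≤s; z<s)
open import Data.Nat.Properties hiding (_≟_)
open import Data.Nat.Tactic.RingSolver using (solve-∀)
open import Data.Bool using (Bool; true; false; _xor_)
open import Data.Bool.Properties using (¬-not; xor-same; xor-comm)
open import Data.Fin using (Fin; _≟_)
open import Data.Fin.Subset
  using (Subset; inside; outside; _∈_; _∉_; _∩_; ∁; ∣_∣; ⁅_⁆; Nonempty; Empty)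
open import Data.Fin.Subset.Properties
  using (_∈?_; nonempty?; Empty-unique; ∣⊥∣≡0; ∣p∣≤n; ∣∁p∣≡n∸∣p∣; ∣⁅x⁆∣≡1; ∩-assoc;
         p⊆q⇒∣p∣≤∣q∣; ∣p∩q∣≤∣q∣; x∈p∩q⁺; x∈p∩q⁻; x∈p⇒∣p-x∣<∣p∣;
         x∈∁p⇒x∉p; x∉p⇒x∈∁p; x∉∁p⇒x∈p; x∉⁅y⁆⇒x≢y)
open import Data.Vec using ([]; _∷_; tabulate; lookup)
open import Data.Vec.Properties using ([]=⇒lookup; lookup⇒[]=; lookup∘tabulate)
open import Data.Product using (Σ; _×_; _,_; proj₁; proj₂)
open import Data.Sum using (inj₂; [_,_]′)
open import Data.Empty using (⊥)
open import Function using (_∘_)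
open import Relation.Nullary using (¬_; Dec; yes; no; contradiction)
open import Relation.Binary.PropositionalEquality
  using (_≡_; _≢_; refl; trans; cong; subst; module ≡-Reasoning) renaming (sym to ≡-sym)

private
  variable
    n k i j a b : ℕ
    p q S T : Subset n

x∈tabulate⁺ : {f : Fin n → Bool} {x : Fin n} → f x ≡ true → x ∈ tabulate f
x∈tabulate⁺ {f = f} {x} fx = lookup⇒[]= x (tabulate f) (trans (lookup∘tabulate f x) fx)

x∈tabulate⁻ : {f : Fin n → Bool} {x : Fin n} → x ∈ tabulate f → f x ≡ true
x∈tabulate⁻ {f = f} {x} x∈ = trans (≡-sym (lookup∘tabulate f x)) ([]=⇒lookup x∈)

x∉p⇒lookup≡false : {x : Fin n} → x ∉ p → lookup p x ≡ false
x∉p⇒lookup≡false {p = p} {x} x∉p = ¬-not (x∉p ∘ lookup⇒[]= x p)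

Nonempty⇒0<∣p∣ : Nonempty p → 0 < ∣ p ∣
Nonempty⇒0<∣p∣ (x , x∈p) = m<n⇒0<n (x∈p⇒∣p-x∣<∣p∣ x∈p)

Empty⇒∣p∣≡0 : Empty p → ∣ p ∣ ≡ 0
Empty⇒∣p∣≡0 {n} e = trans (cong ∣_∣ (Empty-unique e)) (∣⊥∣≡0 n)

∣p∣≡∣p∩q∣+∣p∩∁q∣ : (p q : Subset n) → ∣ p ∣ ≡ ∣ p ∩ q ∣ + ∣ p ∩ ∁ q ∣
∣p∣≡∣p∩q∣+∣p∩∁q∣ []            []            = refl
∣p∣≡∣p∩q∣+∣p∩∁q∣ (inside  ∷ p) (inside  ∷ q) = cong suc (∣p∣≡∣p∩q∣+∣p∩∁q∣ p q)
∣p∣≡∣p∩q∣+∣p∩∁q∣ (inside  ∷ p) (outside ∷ q) =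
  trans (cong suc (∣p∣≡∣p∩q∣+∣p∩∁q∣ p q)) (≡-sym (+-suc _ _))
∣p∣≡∣p∩q∣+∣p∩∁q∣ (outside ∷ p) (inside  ∷ q) = ∣p∣≡∣p∩q∣+∣p∩∁q∣ p q
∣p∣≡∣p∩q∣+∣p∩∁q∣ (outside ∷ p) (outside ∷ q) = ∣p∣≡∣p∩q∣+∣p∩∁q∣ p q

∣p∣+∣∁p∣≡n : (p : Subset n) → ∣ p ∣ + ∣ ∁ p ∣ ≡ n
∣p∣+∣∁p∣≡n p = trans (cong (∣ p ∣ +_) (∣∁p∣≡n∸∣p∣ p)) (m+[n∸m]≡n (∣p∣≤n p))

select : Subset n → ℕ → ℕ → Subset n
select []            a       b       = []
select (inside  ∷ p) zero    b       = outside ∷ select p zero b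
select (inside  ∷ p) (suc a) b       = inside ∷ select p a b
select (outside ∷ p) a       zero    = outside ∷ select p a zero
select (outside ∷ p) a       (suc b) = inside ∷ select p a b

∣select∩p∣≤ : ∀ (p : Subset n) a b → ∣ select p a b ∩ p ∣ ≤ a
∣select∩p∣≤ []            a       b       = z≤n
∣select∩p∣≤ (inside  ∷ p) zero    b       = ∣select∩p∣≤ p zero b
∣select∩p∣≤ (inside  ∷ p) (suc a) b       = s≤s (∣select∩p∣≤ p a b)
∣select∩p∣≤ (outside ∷ p) a       zero    = ∣select∩p∣≤ p a zero
∣select∩p∣≤ (outside ∷ p) a       (suc b) = ∣select∩p∣≤ p a b

∣select∩∁p∣≤ : ∀ (p : Subset n) a b → ∣ select p a b ∩ ∁ p ∣ ≤ b
∣select∩∁p∣≤ []            a       b       = z≤n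
∣select∩∁p∣≤ (inside  ∷ p) zero    b       = ∣select∩∁p∣≤ p zero b
∣select∩∁p∣≤ (inside  ∷ p) (suc a) b       = ∣select∩∁p∣≤ p a b
∣select∩∁p∣≤ (outside ∷ p) a       zero    = ∣select∩∁p∣≤ p a zero
∣select∩∁p∣≤ (outside ∷ p) a       (suc b) = s≤s (∣select∩∁p∣≤ p a b)

∣select∣≡ : ∀ (p : Subset n) {a b} → a ≤ ∣ p ∣ → b ≤ ∣ ∁ p ∣ → ∣ select p a b ∣ ≡ a + b
∣select∣≡ []            {zero}  {zero}  _        _        = refl
∣select∣≡ (inside  ∷ p) {zero}  {b}     _        b≤       = ∣select∣≡ p z≤n b≤
∣select∣≡ (inside  ∷ p) {suc a} {b}     (s≤s a≤) b≤       = cong suc (∣select∣≡ p a≤ b≤)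
∣select∣≡ (outside ∷ p) {a}     {zero}  a≤       _        = ∣select∣≡ p a≤ z≤n
∣select∣≡ (outside ∷ p) {a}     {suc b} a≤       (s≤s b≤) =
  trans (cong suc (∣select∣≡ p a≤ b≤)) (≡-sym (+-suc a b))

Independent : Graph n → Subset n → Set
Independent G q = ∀ {u v} → u ∈ q → v ∈ q → adj G u v ≡ false

Clique : Graph n → Subset n → Set
Clique G q = ∀ {u v} → u ∈ q → v ∈ q → u ≢ v → adj G u v ≡ true

Complete : Graph n → Subset n → Subset n → Set
Complete G p q = ∀ {u v} → u ∈ p → v ∈ q → adj G u v ≡ true

Bipartition : Graph n → Subset n → Set
Bipartition G T = Independent G T × Independent G (∁ T)

independent⇒clique-complement : (G : Graph n) → Independent G q → Clique (complement G) q
independent⇒clique-complement G ind {u} {v} u∈q v∈q u≢v rewrite ind u∈q v∈q with u ≟ v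
... | yes u≡v = contradiction u≡v u≢v
... | no _    = refl

bipartite⇒bipartition : (G : Graph n) → Bipartite G → Σ (Subset n) (Bipartition G)
bipartite⇒bipartition {n} G (c , proper) = tabulate c , sameColour x∈tabulate⁻ , sameColour in∁T
  where
  in∁T : ∀ {u} → u ∈ ∁ (tabulate c) → c u ≡ false
  in∁T u∈ = ¬-not (x∈∁p⇒x∉p u∈ ∘ x∈tabulate⁺)

  sameColour : ∀ {p : Subset n} {β} → (∀ {u} → u ∈ p → c u ≡ β) → Independent G p
  sameColour colour {u} {v} u∈p v∈p =
    ¬-not λ uv → proper u v uv (trans (colour u∈p) (≡-sym (colour v∈p)))

module _ (G : Graph n) where

  degree≤∣S∩p∣ : ∀ S {v} → (∀ {x} → x ∈ S → adj G v x ≡ true → x ∈ p) → inducedDegree G S v ≤ ∣ S ∩ p ∣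
  degree≤∣S∩p∣ S {v} nbrs∈p = p⊆q⇒∣p∣≤∣q∣ λ x∈ →
    let x∈N , x∈S = x∈p∩q⁻ (nbhd G v) S x∈ in x∈p∩q⁺ (x∈S , nbrs∈p x∈S (x∈tabulate⁻ x∈N))

  ∣S∩p∣≤degree : ∀ S {v} → (∀ {x} → x ∈ p → adj G v x ≡ true) → ∣ S ∩ p ∣ ≤ inducedDegree G S v
  ∣S∩p∣≤degree {p} S {v} p⊆nbrs = p⊆q⇒∣p∣≤∣q∣ λ x∈ →
    let x∈S , x∈p = x∈p∩q⁻ S p x∈ in x∈p∩q⁺ (x∈tabulate⁺ (p⊆nbrs x∈p) , x∈S)

  neighbour∉ : Independent G q → ∀ {v x} → v ∈ q → adj G v x ≡ true → x ∉ q
  neighbour∉ ind v∈q vx x∈q = contradiction (trans (≡-sym (ind v∈q x∈q)) vx) λ ()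

  complete-sparse : Complete G p q → MaxDegAtMost k G S → Nonempty (S ∩ p) → ∣ S ∩ q ∣ ≤ k
  complete-sparse {p} {S = S} cpl sparse (v , v∈S∩p) =
    let v∈S , v∈p = x∈p∩q⁻ S p v∈S∩p in ≤-trans (∣S∩p∣≤degree S (cpl v∈p)) (sparse v v∈S)

  -- Apart from one vertex v, S ∩ q lies in the neighbourhood of v.
  clique-sparse : Clique G q → MaxDegAtMost k G S → ∣ S ∩ q ∣ ≤ suc k
  clique-sparse {q} {k} {S} clq sparse with nonempty? (S ∩ q)
  ... | no empty = subst (_≤ suc k) (≡-sym (Empty⇒∣p∣≡0 empty)) z≤n
  ... | yes (v , v∈S∩q) = begin
    ∣ S ∩ q ∣                                  ≡⟨ ∣p∣≡∣p∩q∣+∣p∩∁q∣ (S ∩ q) ⁅ v ⁆ ⟩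
    ∣ (S ∩ q) ∩ ⁅ v ⁆ ∣ + ∣ (S ∩ q) ∩ ∁ ⁅ v ⁆ ∣ ≡⟨ cong (∣ (S ∩ q) ∩ ⁅ v ⁆ ∣ +_) (cong ∣_∣ (∩-assoc S q _)) ⟩
    ∣ (S ∩ q) ∩ ⁅ v ⁆ ∣ + ∣ S ∩ q ∩ ∁ ⁅ v ⁆ ∣   ≤⟨ +-mono-≤ atMostOne (∣S∩p∣≤degree S adjacent) ⟩
    1 + inducedDegree G S v                    ≤⟨ +-monoʳ-≤ 1 (sparse v v∈S) ⟩
    suc k                                      ∎
    where
    open ≤-Reasoning
    v∈S = proj₁ (x∈p∩q⁻ S q v∈S∩q)
    v∈q = proj₂ (x∈p∩q⁻ S q v∈S∩q)
    atMostOne : ∣ (S ∩ q) ∩ ⁅ v ⁆ ∣ ≤ 1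
    atMostOne = subst (∣ (S ∩ q) ∩ ⁅ v ⁆ ∣ ≤_) (∣⁅x⁆∣≡1 v) (∣p∩q∣≤∣q∣ (S ∩ q) ⁅ v ⁆)
    adjacent : ∀ {x} → x ∈ q ∩ ∁ ⁅ v ⁆ → adj G v x ≡ true
    adjacent {x} x∈ = let x∈q , x∉v = x∈p∩q⁻ q (∁ ⁅ v ⁆) x∈ in
      clq v∈q x∈q λ v≡x → x∉⁅y⁆⇒x≢y (x∈∁p⇒x∉p x∉v) (≡-sym v≡x)

  bipartition-sparse : Bipartition G T → ∀ S →
    (Nonempty (S ∩ T) → ∣ S ∩ ∁ T ∣ ≤ k) → (Nonempty (S ∩ ∁ T) → ∣ S ∩ T ∣ ≤ k) → MaxDegAtMost k G S
  bipartition-sparse {T} (indT , ind∁T) S bound∁T boundT v v∈S with v ∈? T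
  ... | yes v∈T = ≤-trans (degree≤∣S∩p∣ S λ _ vx → x∉p⇒x∈∁p (neighbour∉ indT v∈T vx))
                          (bound∁T (v , x∈p∩q⁺ (v∈S , v∈T)))
  ... | no v∉T  = ≤-trans (degree≤∣S∩p∣ S λ _ vx → x∉∁p⇒x∈p (neighbour∉ ind∁T (x∉p⇒x∈∁p v∉T) vx))
                          (boundT (v , x∈p∩q⁺ (v∈S , x∉p⇒x∈∁p v∉T)))

  bipartition-select : Bipartition G T → a ≤ ∣ T ∣ → b ≤ ∣ ∁ T ∣ →
    (0 < a → b ≤ k) → (0 < b → a ≤ k) → HasSparseSet k (a + b) G
  bipartition-select {T} {a} {b} bip a≤ b≤ b≤k a≤k =
    select T a b , ∣select∣≡ T a≤ b≤ , bipartition-sparse bip (select T a b)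
      (λ ne → ≤-trans (∣select∩∁p∣≤ T a b) (b≤k (≤-trans (Nonempty⇒0<∣p∣ ne) (∣select∩p∣≤ T a b))))
      (λ ne → ≤-trans (∣select∩p∣≤ T a b) (a≤k (≤-trans (Nonempty⇒0<∣p∣ ne) (∣select∩∁p∣≤ T a b))))

bipartition-dense : (G : Graph n) → Bipartition G T → HasDenseSet k i G → i ≤ suc k + suc k
bipartition-dense {T = T} {i = i} G (indT , ind∁T) (S , ∣S∣≡i , sparse) = begin
  i                        ≡⟨ ≡-sym ∣S∣≡i ⟩
  ∣ S ∣                    ≡⟨ ∣p∣≡∣p∩q∣+∣p∩∁q∣ S T ⟩
  ∣ S ∩ T ∣ + ∣ S ∩ ∁ T ∣  ≤⟨ +-mono-≤ (meetsClass indT) (meetsClass ind∁T) ⟩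
  suc _ + suc _            ∎
  where
  open ≤-Reasoning
  meetsClass : Independent G q → ∣ S ∩ q ∣ ≤ suc _
  meetsClass ind = clique-sparse (complement G) (independent⇒clique-complement G ind) sparse

bipartition-noDense : (G : Graph n) → Bipartition G T → 2 * k + 3 ≤ i → ¬ HasDenseSet k i G
bipartition-noDense {k = k} {i = i} G bip i-large dense =
  1+n≰n (≤-trans (subst (_≤ i) (2k+3≡1+[1+k]+[1+k] k) i-large) (bipartition-dense G bip dense))
  where
  2k+3≡1+[1+k]+[1+k] : ∀ k → 2 * k + 3 ≡ suc (suc k + suc k)
  2k+3≡1+[1+k]+[1+k] = solve-∀

completeBipartite : Subset n → Graph n
completeBipartite T = record
  { adj    = λ u v → lookup T u xor lookup T v
  ; sym    = λ u v → xor-comm (lookup T u) (lookup T v)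
  ; irrefl = λ v → xor-same (lookup T v)
  }

completeBipartite-bipartite : (T : Subset n) → Bipartite (completeBipartite T)
completeBipartite-bipartite T = lookup T , λ u v uv Tu≡Tv →
  contradiction (trans (≡-sym (xor-same (lookup T v))) (subst (λ β → (β xor lookup T v) ≡ true) Tu≡Tv uv))
                λ ()

completeBipartite-bipartition : (T : Subset n) → Bipartition (completeBipartite T) T
completeBipartite-bipartition T = inT , in∁T
  where
  inT : Independent (completeBipartite T) T
  inT u∈ v∈ rewrite []=⇒lookup u∈ | []=⇒lookup v∈ = refl
  in∁T : Independent (completeBipartite T) (∁ T)
  in∁T u∈ v∈ rewrite x∉p⇒lookup≡false (x∈∁p⇒x∉p u∈) | x∉p⇒lookup≡false (x∈∁p⇒x∉p v∈) = refl

completeBipartite-complete : (T : Subset n) → Complete (completeBipartite T) T (∁ T)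
completeBipartite-complete T u∈ v∈ rewrite []=⇒lookup u∈ | x∉p⇒lookup≡false (x∈∁p⇒x∉p v∈) = refl

completeBipartite-noSparse : (T : Subset n) → ∣ T ∣ < j → ∣ ∁ T ∣ < j →
  (j ≤ k + k → k + ∣ ∁ T ∣ < j) → ¬ HasSparseSet k j (completeBipartite T)
completeBipartite-noSparse {j = j} {k} T ∣T∣<j ∣∁T∣<j mixed<j (S , ∣S∣≡j , sparse) =
  byCases (nonempty? (S ∩ T)) (nonempty? (S ∩ ∁ T))
  where
  j≤ : j ≤ ∣ S ∩ T ∣ + ∣ S ∩ ∁ T ∣
  j≤ = ≤-reflexive (trans (≡-sym ∣S∣≡j) (∣p∣≡∣p∩q∣+∣p∩∁q∣ S T))

  byCases : Dec (Nonempty (S ∩ T)) → Dec (Nonempty (S ∩ ∁ T)) → ⊥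
  byCases (no noneInT) _ =
    <⇒≱ ∣∁T∣<j (≤-trans j≤ (+-mono-≤ (≤-reflexive (Empty⇒∣p∣≡0 noneInT)) (∣p∩q∣≤∣q∣ S (∁ T))))
  byCases (yes _) (no noneIn∁T) =
    <⇒≱ ∣T∣<j (≤-trans j≤ (≤-trans (+-mono-≤ (∣p∩q∣≤∣q∣ S T) (≤-reflexive (Empty⇒∣p∣≡0 noneIn∁T)))
                                    (≤-reflexive (+-identityʳ ∣ T ∣))))
  byCases (yes someInT) (yes someIn∁T) =
    <⇒≱ (mixed<j (≤-trans j≤ (+-mono-≤ inT≤k in∁T≤k)))
        (≤-trans j≤ (+-mono-≤ inT≤k (∣p∩q∣≤∣q∣ S (∁ T))))
    where
    G = completeBipartite T
    inT≤k : ∣ S ∩ T ∣ ≤ k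
    inT≤k = complete-sparse G (λ u∈ v∈ → trans (Graph.sym G _ _) (completeBipartite-complete T v∈ u∈))
                            sparse someIn∁T
    in∁T≤k : ∣ S ∩ ∁ T ∣ ≤ k
    in∁T≤k = complete-sparse G (completeBipartite-complete T) sparse someInT

initialSegment : (n a : ℕ) → Subset n
initialSegment zero    a       = []
initialSegment (suc n) zero    = outside ∷ initialSegment n zero
initialSegment (suc n) (suc a) = inside ∷ initialSegment n a

∣initialSegment∣≤ : ∀ n a → ∣ initialSegment n a ∣ ≤ a
∣initialSegment∣≤ zero    a       = z≤n
∣initialSegment∣≤ (suc n) zero    = ∣initialSegment∣≤ n zero
∣initialSegment∣≤ (suc n) (suc a) = s≤s (∣initialSegment∣≤ n a)

∣∁initialSegment∣≤ : ∀ n a → ∣ ∁ (initialSegment n a) ∣ ≤ n ∸ a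
∣∁initialSegment∣≤ zero    a       = z≤n
∣∁initialSegment∣≤ (suc n) zero    = s≤s (∣∁initialSegment∣≤ n zero)
∣∁initialSegment∣≤ (suc n) (suc a) = ∣∁initialSegment∣≤ n a

2[1+j]∸1∸k+[1+k]≡[1+j]+[1+j] : ∀ j k → k ≤ j → 2 * suc j ∸ 1 ∸ k + suc k ≡ suc j + suc j
2[1+j]∸1∸k+[1+k]≡[1+j]+[1+j] j k k≤j = begin
  2 * suc j ∸ 1 ∸ k + suc k    ≡⟨ +-suc _ k ⟩
  suc (2 * suc j ∸ 1 ∸ k + k)  ≡⟨ cong suc (m∸n+n≡m (≤-trans k≤j (m≤m+n j _))) ⟩
  suc (j + suc (j + 0))        ≡⟨ cong (λ m → suc (j + suc m)) (+-identityʳ j) ⟩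
  suc j + suc j                ∎
  where open ≡-Reasoning

m+n+[1+o]≡p+p⇒n<p⇒p≤m+o : ∀ m n o p → m + n + suc o ≡ p + p → n < p → p ≤ m + o
m+n+[1+o]≡p+p⇒n<p⇒p≤m+o m n o p total n<p = +-cancelʳ-≤ p p (m + o) (begin
  p + p              ≡⟨ ≡-sym total ⟩
  m + n + suc o      ≡⟨ rearrange m n o ⟩
  m + o + suc n      ≤⟨ +-monoʳ-≤ (m + o) n<p ⟩
  m + o + p          ∎)
  where
  open ≤-Reasoning
  rearrange : ∀ m n o → m + n + suc o ≡ m + o + suc n
  rearrange = solve-∀

m<n⇒n+[1+k]≡[1+j]+[1+j]⇒k+[m∸j]≤j : ∀ {m n} k j → m < n → n + suc k ≡ suc j + suc j → k ≤ j →
  k + (m ∸ j) ≤ j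
m<n⇒n+[1+k]≡[1+j]+[1+j]⇒k+[m∸j]≤j {m} {n} k j m<n total k≤j = begin
  k + (m ∸ j)  ≤⟨ +-monoʳ-≤ k (m≤n+o⇒m∸n≤o m j m≤j+[j∸k]) ⟩
  k + (j ∸ k)  ≡⟨ m+[n∸m]≡n k≤j ⟩
  j            ∎
  where
  open ≤-Reasoning
  m+k≤j+j : m + k ≤ j + j
  m+k≤j+j = ≤-pred (≤-pred (begin
    suc (suc (m + k))  ≡⟨ cong suc (≡-sym (+-suc m k)) ⟩
    suc m + suc k      ≤⟨ +-monoˡ-≤ (suc k) m<n ⟩
    n + suc k          ≡⟨ total ⟩
    suc j + suc j      ≡⟨ cong suc (+-suc j j) ⟩
    suc (suc (j + j))  ∎))
  m≤j+[j∸k] : m ≤ j + (j ∸ k)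
  m≤j+[j∸k] = subst (m ≤_) (+-∸-assoc j k≤j) (m+n≤o⇒m≤o∸n m m+k≤j+j)

module _ (G : Graph n) (bip : Bipartition G T) where

  inside-sparse : j ≤ ∣ T ∣ → HasSparseSet k j G
  inside-sparse {j} j≤ =
    subst (λ m → HasSparseSet _ m G) (+-identityʳ j) (bipartition-select G bip j≤ z≤n (λ _ → z≤n) λ ())

  outside-sparse : j ≤ ∣ ∁ T ∣ → HasSparseSet k j G
  outside-sparse j≤ = bipartition-select G bip z≤n j≤ (λ ()) (λ _ → z≤n)

  oneSide-sparse : ∣ T ∣ + ∣ ∁ T ∣ + 1 ≡ j + j → HasSparseSet k j G
  oneSide-sparse {j} total with j ≤? ∣ T ∣
  ... | yes j≤t = inside-sparse j≤t
  ... | no j≰t  = outside-sparse (subst (j ≤_) (+-identityʳ _)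
    (m+n+[1+o]≡p+p⇒n<p⇒p≤m+o ∣ ∁ T ∣ ∣ T ∣ 0 j (trans (cong (_+ 1) (+-comm ∣ ∁ T ∣ ∣ T ∣)) total)
                             (≰⇒> j≰t)))

  -- If neither side has j vertices, take min (∣ T ∣ , k) vertices from T and the rest from ∁ T.
  balanced-sparse : k < j → j ≤ k + k → ∣ T ∣ + ∣ ∁ T ∣ + suc k ≡ j + j → HasSparseSet k j G
  balanced-sparse {k} {j} k<j j≤k+k total with j ≤? ∣ T ∣ | j ≤? ∣ ∁ T ∣ | ∣ T ∣ ≤? k
  ... | yes j≤t | _       | _      = inside-sparse j≤t
  ... | no _    | yes j≤f | _      = outside-sparse j≤f
  ... | no j≰t  | no j≰f  | yes t≤k =
    subst (λ m → HasSparseSet k m G) (m+[n∸m]≡n (<⇒≤ (≰⇒> j≰t)))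
      (bipartition-select G bip ≤-refl (m≤n+o⇒m∸n≤o j t j≤t+f)
                                (λ _ → m≤n+o⇒m∸n≤o j t j≤t+k) (λ _ → t≤k))
    where
    t = ∣ T ∣
    j≤t+f : j ≤ t + ∣ ∁ T ∣
    j≤t+f = +-cancelʳ-≤ (suc k) j _ (subst (j + suc k ≤_) (≡-sym total) (+-monoʳ-≤ j k<j))
    j≤t+k : j ≤ t + k
    j≤t+k = m+n+[1+o]≡p+p⇒n<p⇒p≤m+o t ∣ ∁ T ∣ k j total (≰⇒> j≰f)
  ... | no j≰t  | no _    | no t≰k =
    subst (λ m → HasSparseSet k m G) (m+[n∸m]≡n (<⇒≤ k<j))
      (bipartition-select G bip (<⇒≤ (≰⇒> t≰k)) (m≤n+o⇒m∸n≤o j k j≤k+f)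
                                (λ _ → m≤n+o⇒m∸n≤o j k j≤k+k) (λ _ → ≤-refl))
    where
    f = ∣ ∁ T ∣
    j≤k+f : j ≤ k + f
    j≤k+f = subst (j ≤_) (+-comm f k)
      (m+n+[1+o]≡p+p⇒n<p⇒p≤m+o f ∣ T ∣ k j (trans (cong (_+ suc k) (+-comm f ∣ T ∣)) total) (≰⇒> j≰t))

balanced-ramsey : k < j → j ≤ k + k → n + suc k ≡ j + j → RamseyPropBIP k i j n
balanced-ramsey k<j j≤k+k total G bipartite =
  let T , bip = bipartite⇒bipartition G bipartite in
  inj₂ (balanced-sparse G bip k<j j≤k+k (trans (cong (_+ suc _) (∣p∣+∣∁p∣≡n T)) total))

oneSide-ramsey : n + 1 ≡ j + j → RamseyPropBIP k i j n
oneSide-ramsey total G bipartite =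
  let T , bip = bipartite⇒bipartition G bipartite in
  inj₂ (oneSide-sparse G bip (trans (cong (_+ 1) (∣p∣+∣∁p∣≡n T)) total))

initialSegment-nonRamsey : 2 * k + 3 ≤ i → n ∸ j ≤ j → (suc j ≤ k + k → k + (n ∸ j) ≤ j) →
  ¬ RamseyPropBIP k i (suc j) n
initialSegment-nonRamsey {k} {n = n} {j} i-large n∸j≤j mixed≤j ramsey =
  [ bipartition-noDense (completeBipartite seg) (completeBipartite-bipartition seg) i-large
  , completeBipartite-noSparse seg (s≤s (∣initialSegment∣≤ n j)) (s≤s (≤-trans ∣∁seg∣≤ n∸j≤j))
      (λ j<k+k → s≤s (≤-trans (+-monoʳ-≤ k ∣∁seg∣≤) (mixed≤j j<k+k)))
  ]′ (ramsey (completeBipartite seg) (completeBipartite-bipartite seg))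
  where
  seg = initialSegment n j
  ∣∁seg∣≤ = ∣∁initialSegment∣≤ n j

theorem5p5 : (k i j : ℕ) → 2 ≤ k → 2 * k + 3 ≤ i → k + 2 ≤ j →
    (j ≤ 2 * k → RBIP≡ k i j (2 * j ∸ 1 ∸ k)) ×
    (2 * k + 1 ≤ j → RBIP≡ k i j (2 * j ∸ 1))
theorem5p5 k i zero    _ _       k+2≤0   = contradiction (m+n≤o⇒n≤o k k+2≤0) λ ()
theorem5p5 k i (suc j) _ i-large k+2≤1+j = smallJ , largeJ
  where
  k≤j : k ≤ j
  k≤j = ≤-pred (<-≤-trans (m<m+n k z<s) k+2≤1+j)

  threshold : ∀ l → l ≤ j → 2 * suc j ∸ 1 ∸ l + suc l ≡ suc j + suc j
  threshold l = 2[1+j]∸1∸k+[1+k]≡[1+j]+[1+j] j l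

  below : ∀ l {m} → l ≤ j → m < 2 * suc j ∸ 1 ∸ l → l + (m ∸ j) ≤ j
  below l l≤j m<n = m<n⇒n+[1+k]≡[1+j]+[1+j]⇒k+[m∸j]≤j l j m<n (threshold l l≤j) l≤j

  smallJ : suc j ≤ 2 * k → RBIP≡ k i (suc j) (2 * suc j ∸ 1 ∸ k)
  smallJ 1+j≤2k =
      balanced-ramsey (s≤s k≤j) (subst (suc j ≤_) (cong (k +_) (+-identityʳ k)) 1+j≤2k) (threshold k k≤j)
    , λ m m<n → initialSegment-nonRamsey i-large (m+n≤o⇒n≤o k (below k k≤j m<n)) λ _ → below k k≤j m<n

  largeJ : 2 * k + 1 ≤ suc j → RBIP≡ k i (suc j) (2 * suc j ∸ 1)
  largeJ 2k+1≤1+j =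
      oneSide-ramsey (threshold 0 z≤n)
    , λ m m<n → initialSegment-nonRamsey i-large (below 0 z≤n m<n) λ 1+j≤k+k →
        contradiction (≤-trans (subst (_≤ suc j) (2k+1≡1+k+k k) 2k+1≤1+j) 1+j≤k+k) 1+n≰n
    where
    2k+1≡1+k+k : ∀ k → 2 * k + 1 ≡ suc (k + k)
    2k+1≡1+k+k = solve-∀
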